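{- Let $T$ be a based scheme on a finite based set $X$ (basepoint $x_*$), $U$ a based scheme on a finite based set $Y$ (basepoint $y_*$), and $\zeta$ an action of $U$ on $T$. Then $U\ltimes_\zeta T$ is a based association scheme on $Y\times X$ with basepoint $(y_*,x_*)$.
   Context: All schemes are association schemes on finite sets. For a scheme $S$ on $X$ and closed $T\subseteq S$ (i.e. $T^*T\subseteq T$, complex product $pq=\{r:a_{pqr}>0\}$), $xT=\bigcup_{t\in T}xt$ with $xt=\{y:(x,y)\in t\}$, $X/T=\{xT\}$, $s^T=\{(x_1T,x_2T):(x_1',x_2')\in s$ for some $x_i'\in x_iT\}$, $S/\!\!/T=\{s^T\}$. Normal: $pT=Tp$ for all $p$. A morphism of schemes is a map of underlying sets sending pairs in a common relation to pairs in a common relation; it induces a map on relations; isomorphism if both maps are bijective. Based schemes carry a basepoint (quotients based at the coset of the basepoint); based morphisms preserve it. Category $\mathcal C$: for based schemes $T$ on $X$, $U$ on $Y$, $\phi\in\mathrm{Hom}_{\mathcal C}(T,U)$ is a triple $(T_\phi,U_\phi,\tilde\phi)$ with $T_\phi,U_\phi$ normal closed subsets of $T,U$ and $\tilde\phi:T/\!\!/T_\phi\to U/\!\!/U_\phi$ a based isomorphism. Composition of $\phi\in\mathrm{Hom}_{\mathcal C}(T,U)$, $\psi\in\mathrm{Hom}_{\mathcal C}(U,V)$ ($V$ on $W$): $T_{\phi\psi}=\{t:\exists u,\ t^{T_\phi}\tilde\phi=u^{U_\phi},\ u^{U_\psi}\tilde\psi=1_W^{V_\psi}\}$, $V_{\phi\psi}=\{v:\exists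 u,\ 1_X^{T_\phi}\tilde\phi=u^{U_\phi},\ u^{U_\psi}\tilde\psi=v^{V_\psi}\}$, $(xT_{\phi\psi})\widetilde{\phi\psi}=wV_{\phi\psi}$ where $(xT_\phi)\tilde\phi=yU_\phi$, $(yU_\psi)\tilde\psi=wV_\psi$. $\mathrm{id}_T=(\{1_X\},\{1_X\},\mathrm{id})$. $\phi\le\psi$ means $T_\phi\subseteq T_\psi$, $U_\phi\subseteq U_\psi$, $(xT_\phi)\tilde\phi\subseteq(xT_\psi)\tilde\psi$ for all $x$. $\phi^*\in\mathrm{Hom}_{\mathcal C}(U,T)$ has the same two subsets and isomorphism $\tilde\phi^{ -1}$. $\tau=\tau_T$ is the set $T$ with its involution, distinguished element $1=1_X$, and constants $a_{pqr}$. A $\tau$-scheme is $(T',\alpha)$ with $T'$ a scheme on a based set and $\alpha:\tau\to T'$ a bijection with $1\alpha$ the diagonal, $(p^*)\alpha=(p\alpha)^*$, $a_{(p\alpha)(q\alpha)(r\alpha)}=a_{pqr}$. For $\tau$-schemes $(T_1,\alpha),(T_2,\beta)$, $\phi\in\mathrm{Hom}_{\mathcal C}(T_1,T_2)$, $\phi(\tau):\mathcal P(\tau)\to\mathcal P(\tau)$ sends $P$ to $\{u:(t\alpha)^{(T_1)_\phi}\tilde\phi=(u\beta)^{(T_2)_\phi}$ for some $t\in P\}$. An action $\zeta$ of $U$ on $T$ consists of $\tau$-schemes $\zeta_y=(T_y,\alpha^y)$ ($T_y$ a scheme on $X$) for $y\in Y$ and $\zeta_{y_1}^{y_2}\in\mathrm{Hom}_{\mathcal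 C}(T_{y_1},T_{y_2})$ for $y_1,y_2\in Y$, such that (1) $T_{y_*}=T$, $\alpha^{y_*}=\mathrm{id}$; (2) $\zeta_y^y=\mathrm{id}_{T_y}$; (3) $\zeta_{y_2}^{y_1}=(\zeta_{y_1}^{y_2})^*$; (4) $\zeta_{y_1}^{y_2}(\tau)$ depends only on the $u\in U$ containing $(y_1,y_2)$; (5) $\zeta_{y_1}^{y_3}\le\zeta_{y_1}^{y_2}\zeta_{y_2}^{y_3}$. Put $T'_{y_1y_2}=(T_{y_1})_{\zeta_{y_1}^{y_2}}$, $T''_{y_1y_2}=(T_{y_2})_{\zeta_{y_1}^{y_2}}$. For $u\in U$, $t\in\tau$, $[u,t]$ is the set of $((y_1,x_1),(y_2,x_2))\in(Y\times X)^2$ with $(y_1,y_2)\in u$ and $((x_1T'_{y_1y_2})\tilde\zeta_{y_1}^{y_2},x_2T''_{y_1y_2})\in(t\alpha^{y_2})^{T''_{y_1y_2}}$; $U\ltimes_\zeta T$ is the set of all $[u,t]$. -}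

module Defs where

open import Data.Nat using (ℕ; zero; suc; _+_; _<_)
open import Data.Fin using (Fin)
import Data.Fin as F
open import Data.Bool using (Bool; true; false; _∧_; _∨_; if_then_else_; T)
open import Data.List using (List; []; _∷_; allFin; cartesianProduct)
open import Data.Product using (Σ; _×_; _,_; proj₁; proj₂)
open import Function using (_∘_)
open import Function.Bundles using (_⇔_)
open import Relation.Binary.PropositionalEquality using (_≡_)

anyF : ∀ {n} → (Fin n → Bool) → Bool
anyF {zero}  P = false
anyF {suc n} P = P F.zero ∨ anyF (P ∘ F.suc)

countL : ∀ {A : Set} → List A → (A → Bool) → ℕ
countL []       P = 0
countL (x ∷ xs) P = (if P x then 1 else 0) + countL xs P

Rel : Set → Set
Rel A = A → A → Bool

-- A family of relations R i (i : I) on a finite set A (enumerated,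
-- without repetition, by the list `elems`) whose SET OF VALUES
-- {R i : i ∈ I} is an association scheme on A.

SameRel : ∀ {A I : Set} → (I → Rel A) → I → I → Set
SameRel R i j = ∀ x y → R i x y ≡ R j x y

module _ {A : Set} (elems : List A) {I : Set} (R : I → Rel A) where

  record IsSchemeFamily : Set where
    field
      nonempty  : ∀ i → Σ A λ x → Σ A λ y → T (R i x y)
      disjoint  : ∀ i j x y → T (R i x y) → T (R j x y) → SameRel R i j
      cover     : ∀ x y → Σ I λ i → T (R i x y)
      diagonal  : Σ I λ i → ∀ x y → T (R i x y) ⇔ (x ≡ y)
      transpose : ∀ i → Σ I λ j → ∀ x y → R j x y ≡ R i y x
      regular   : ∀ i j k x z x' z' → T (R k x z) → T (R k x' z') →
                  countL elems (λ y → R i x y ∧ R j y z)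
                    ≡ countL elems (λ y → R i x' y ∧ R j y z')

record Scheme (n r : ℕ) : Set where
  field
    rel      : Fin r → Rel (Fin n)
    isScheme : IsSchemeFamily (allFin n) rel
    distinct : ∀ i j → SameRel rel i j → i ≡ j
  open IsSchemeFamily isScheme public

module _ {n r : ℕ} (S : Scheme n r) where
  open Scheme S

  one : Fin r
  one = proj₁ diagonal

  star : Fin r → Fin r
  star p = proj₁ (transpose p)

  a : Fin r → Fin r → Fin r → ℕ
  a p q k = countL (allFin n) (λ y → rel p x y ∧ rel q y z)
    where
      x = proj₁ (nonempty k)
      z = proj₁ (proj₂ (nonempty k))

  -- closed subsets (subsets of S given by characteristic functions);
  -- following the usual convention closed subsets are nonempty
  record IsClosed (C : Fin r → Bool) : Set where
    field
      inhabited : Σ (Fin r) λ p → T (C p)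
      closed    : ∀ p q k → T (C p) → T (C q) → 0 < a (star p) q k → T (C k)

  -- normal: pC = Cp for all p (complex products)
  IsNormal : (Fin r → Bool) → Set
  IsNormal C = ∀ p k → (Σ (Fin r) λ t → T (C t) × 0 < a p t k)
                     ⇔ (Σ (Fin r) λ t → T (C t) × 0 < a t p k)

  inCoset : (Fin r → Bool) → Fin n → Fin n → Bool
  inCoset C x y = anyF (λ t → C t ∧ rel t x y)

  InCosetP : (Fin r → Set) → Fin n → Fin n → Set
  InCosetP P x y = Σ (Fin r) λ t → P t × T (rel t x y)

  CosetEq : (Fin r → Bool) → Fin n → Fin n → Set
  CosetEq C x x' = ∀ y → inCoset C x y ≡ inCoset C x' y

  qrel : (Fin r → Bool) → Fin r → Fin n → Fin n → Bool
  qrel C s x₁ x₂ = anyF λ u → anyF λ v →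
    inCoset C x₁ u ∧ inCoset C x₂ v ∧ rel s u v

  QRelEq : (Fin r → Bool) → Fin r → Fin r → Set
  QRelEq C s s' = ∀ x₁ x₂ → qrel C s x₁ x₂ ≡ qrel C s' x₁ x₂

-- Based isomorphisms S//C → S'//C'.  Points of X/C are represented by
-- elements of X (up to CosetEq), relations s^C by s ∈ S (up to QRelEq).
-- f is the map on points, g the induced map on relations.

record BasedIso {n m r r' : ℕ} (x* : Fin n) (y* : Fin m)
                (S : Scheme n r) (C : Fin r → Bool)
                (S' : Scheme m r') (C' : Fin r' → Bool) : Set where
  field
    f       : Fin n → Fin m
    f-resp  : ∀ x x' → CosetEq S C x x' → CosetEq S' C' (f x) (f x')
    f-inj   : ∀ x x' → CosetEq S' C' (f x) (f x') → CosetEq S C x x'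
    f-surj  : ∀ y → Σ (Fin n) λ x → CosetEq S' C' (f x) y
    f-based : CosetEq S' C' (f x*) y*
    g       : Fin r → Fin r'
    g-hom   : ∀ s x₁ x₂ → T (qrel S C s x₁ x₂) → T (qrel S' C' (g s) (f x₁) (f x₂))
    g-inj   : ∀ s s' → QRelEq S' C' (g s) (g s') → QRelEq S C s s'
    g-surj  : ∀ u → Σ (Fin r) λ s → QRelEq S' C' (g s) u

record Hom {n m r r' : ℕ} (x* : Fin n) (y* : Fin m)
           (S : Scheme n r) (S' : Scheme m r') : Set where
  field
    C₁        : Fin r → Bool
    C₁-closed : IsClosed S C₁
    C₁-normal : IsNormal S C₁
    C₂        : Fin r' → Bool
    C₂-closed : IsClosed S' C₂
    C₂-normal : IsNormal S' C₂
    iso       : BasedIso x* y* S C₁ S' C₂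
  open BasedIso iso public

open Hom

IsIdHom : ∀ {n r} {x* : Fin n} {S : Scheme n r} → Hom x* x* S S → Set
IsIdHom {S = S} φ =
  (∀ p → T (C₁ φ p) ⇔ (p ≡ one S)) ×
  (∀ p → T (C₂ φ p) ⇔ (p ≡ one S)) ×
  (∀ x → CosetEq S (C₂ φ) (f φ x) x)

IsDualHom : ∀ {n m r r'} {x* : Fin n} {y* : Fin m}
              {S : Scheme n r} {S' : Scheme m r'} →
            Hom y* x* S' S → Hom x* y* S S' → Set
IsDualHom {S = S} {S' = S'} ψ φ =
  (∀ p → C₁ ψ p ≡ C₂ φ p) ×
  (∀ p → C₂ ψ p ≡ C₁ φ p) ×
  (∀ x → CosetEq S (C₁ φ) (f ψ (f φ x)) x) ×
  (∀ y → CosetEq S' (C₂ φ) (f φ (f ψ y)) y)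

CompC₁ : ∀ {n₁ n₂ n₃ r₁ r₂ r₃} {x₁ : Fin n₁} {x₂ : Fin n₂} {x₃ : Fin n₃}
           {S₁ : Scheme n₁ r₁} {S₂ : Scheme n₂ r₂} {S₃ : Scheme n₃ r₃} →
         Hom x₁ x₂ S₁ S₂ → Hom x₂ x₃ S₂ S₃ → Fin r₁ → Set
CompC₁ {r₂ = r₂} {S₂ = S₂} {S₃ = S₃} φ ψ t =
  Σ (Fin r₂) λ u → QRelEq S₂ (C₂ φ) (g φ t) u × QRelEq S₃ (C₂ ψ) (g ψ u) (one S₃)

CompC₂ : ∀ {n₁ n₂ n₃ r₁ r₂ r₃} {x₁ : Fin n₁} {x₂ : Fin n₂} {x₃ : Fin n₃}
           {S₁ : Scheme n₁ r₁} {S₂ : Scheme n₂ r₂} {S₃ : Scheme n₃ r₃} →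
         Hom x₁ x₂ S₁ S₂ → Hom x₂ x₃ S₂ S₃ → Fin r₃ → Set
CompC₂ {r₂ = r₂} {S₁ = S₁} {S₂ = S₂} {S₃ = S₃} φ ψ v =
  Σ (Fin r₂) λ u → QRelEq S₂ (C₂ φ) (g φ (one S₁)) u × QRelEq S₃ (C₂ ψ) (g ψ u) v

-- χ ≤ φψ   (the map of φψ sends xT_{φψ} to the coset of f_ψ (f_φ x))
IsLeqComp : ∀ {n₁ n₂ n₃ r₁ r₂ r₃} {x₁ : Fin n₁} {x₂ : Fin n₂} {x₃ : Fin n₃}
              {S₁ : Scheme n₁ r₁} {S₂ : Scheme n₂ r₂} {S₃ : Scheme n₃ r₃} →
            Hom x₁ x₃ S₁ S₃ → Hom x₁ x₂ S₁ S₂ → Hom x₂ x₃ S₂ S₃ → Set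
IsLeqComp {S₃ = S₃} χ φ ψ =
  (∀ t → T (C₁ χ t) → CompC₁ φ ψ t) ×
  (∀ v → T (C₂ χ v) → CompC₂ φ ψ v) ×
  (∀ x z → T (inCoset S₃ (C₂ χ) (f χ x) z) → InCosetP S₃ (CompC₂ φ ψ) (f ψ (f φ x)) z)

-- φ(τ)(P) ∋ u'   (for τ-schemes whose relations are indexed by τ = Fin r)
ApplyTau : ∀ {n r} {x* : Fin n} {S S' : Scheme n r} →
           Hom x* x* S S' → (Fin r → Bool) → Fin r → Set
ApplyTau {r = r} {S' = S'} φ P u' =
  Σ (Fin r) λ t → T (P t) × QRelEq S' (C₂ φ) (g φ t) u'

-- τ_S-schemes on X.  A τ-scheme (S', α) is recorded as the scheme S'
-- with its relations indexed through α, i.e. relation i of S' is iα.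
record IsTauScheme {n r} (S S' : Scheme n r) : Set where
  field
    one-diag : ∀ x y → T (Scheme.rel S' (one S) x y) ⇔ (x ≡ y)
    star-pres : ∀ p x y → Scheme.rel S' (star S p) x y ≡ Scheme.rel S' p y x
    a-pres   : ∀ p q k → a S' p q k ≡ a S p q k

record Action {n m r ru} (x* : Fin n) (S : Scheme n r)
              (y* : Fin m) (U : Scheme m ru) : Set where
  field
    Sy      : Fin m → Scheme n r
    tau     : ∀ y → IsTauScheme S (Sy y)
    ζ       : ∀ y₁ y₂ → Hom x* x* (Sy y₁) (Sy y₂)
    based   : ∀ p x x' → Scheme.rel (Sy y*) p x x' ≡ Scheme.rel S p x x'
    ζ-id    : ∀ y → IsIdHom (ζ y y)
    ζ-dual  : ∀ y₁ y₂ → IsDualHom (ζ y₂ y₁) (ζ y₁ y₂)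
    ζ-tau   : ∀ u y₁ y₂ y₁' y₂' → T (Scheme.rel U u y₁ y₂) → T (Scheme.rel U u y₁' y₂') →
              ∀ P t → ApplyTau (ζ y₁ y₂) P t ⇔ ApplyTau (ζ y₁' y₂') P t
    ζ-comp  : ∀ y₁ y₂ y₃ → IsLeqComp (ζ y₁ y₃) (ζ y₁ y₂) (ζ y₂ y₃)

semidirect : ∀ {n m r ru} {x* : Fin n} {S : Scheme n r} {y* : Fin m} {U : Scheme m ru} →
             Action x* S y* U → Fin ru × Fin r → Rel (Fin m × Fin n)
semidirect {U = U} ζa (u , t) (y₁ , x₁) (y₂ , x₂) =
  Scheme.rel U u y₁ y₂ ∧
  qrel (Action.Sy ζa y₂) (C₂ (Action.ζ ζa y₁ y₂)) t (f (Action.ζ ζa y₁ y₂) x₁) x₂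

-- On a fibre pair (y₁, y₂) ∈ u the relation [u, t] is the quotient relation t^{T''} of
-- T_{y₂}, pulled back along ζ̃_{y₁y₂}.  Axiom (4), used at u and at u*, shows that the
-- quotient class of t it determines depends only on u, so the partition, diagonal and
-- transposition axioms reduce to the same facts for the quotient schemes T_{y₂}//T''.
-- For regularity, the paths (y₁,x₁) → (y₂,x₂) → (y₃,x₃) of type ([u,t],[u',t']) are
-- counted fibrewise: over each y₂ on a U-path of type (u,u') the number of x₂ is a count
-- of two-step paths in T_{y₂} through the normal closed subsets B = T''_{y₁y₂} and
-- A = T''_{y₃y₂}.  Normality makes that count invariant when either endpoint moves in
-- its class for the join of A and B, and axiom (5) moves the endpoints onto a pair of
-- the relation determined by t'', where the count is a sum of intersection numbers of
-- T; hence the total is a_{uu'u''} of U times a constant.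

module Submission where

open import Defs
open import Data.Nat using (ℕ; zero; suc; _+_; _*_; _<_; z≤n; s≤s)
open import Data.Nat.Properties using (+-assoc; +-identityʳ; +-*-semiring)
open import Data.Fin using (Fin; punchIn) renaming (zero to fz; suc to fs)
open import Data.Fin.Properties using (_≟_; punchInᵢ≢i)
open import Data.Bool using (Bool; true; false; _∧_; _∨_; if_then_else_; T)
open import Data.Bool.Properties using (T-∧; ∧-zeroʳ; ∧-identityʳ)
open import Data.List using (List; []; _∷_; allFin; tabulate; cartesianProduct; map; _++_)
open import Data.List.Membership.Propositional using (_∈_)
open import Data.List.Membership.Propositional.Properties using (∈-allFin)
open import Data.List.Relation.Unary.Any using (here; there)
open import Data.Product using (Σ; ∃; ∃₂; _×_; _,_; proj₁; proj₂)
open import Data.Empty using (⊥-elim)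
open import Data.Unit using (tt)
open import Function using (_∘_; id)
open import Function.Bundles using (_⇔_; mk⇔; Equivalence)
open import Relation.Binary.PropositionalEquality
  using (_≡_; refl; sym; trans; cong; cong₂; subst; module ≡-Reasoning)
open import Relation.Nullary using (¬_)
open import Relation.Nullary.Decidable using (⌊_⌋; toWitness; fromWitness)
open import Algebra.Properties.Semiring.Sum +-*-semiring
  using (sum; sum-cong-≗; sum-remove; sum-replicate-zero; ∑-comm; *-distribʳ-sum)

open Equivalence

T-ext : ∀ {a b} → (T a → T b) → (T b → T a) → a ≡ b
T-ext {false} {false} _ _ = refl
T-ext {false} {true}  _ g = ⊥-elim (g tt)
T-ext {true}  {false} f _ = ⊥-elim (f tt)
T-ext {true}  {true}  _ _ = refl

T-subst : ∀ {a b} → a ≡ b → T a → T b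
T-subst refl = id

∧-intro : ∀ {a b} → T a → T b → T (a ∧ b)
∧-intro p q = from T-∧ (p , q)

∧-proj₁ : ∀ {a b} → T (a ∧ b) → T a
∧-proj₁ h = proj₁ (to T-∧ h)

∧-proj₂ : ∀ {a b} → T (a ∧ b) → T b
∧-proj₂ {a} h = proj₂ (to (T-∧ {a}) h)

∧-cong-gated : ∀ {a a' b b'} → a ≡ a' → (T a → b ≡ b') → a ∧ b ≡ a' ∧ b'
∧-cong-gated {false} refl _ = refl
∧-cong-gated {true}  refl f = f tt

if-cong-gated : ∀ {A : Set} c {x y z : A} → (T c → x ≡ y) → (if c then x else z) ≡ (if c then y else z)
if-cong-gated false _ = refl
if-cong-gated true  f = f tt

T⇒≡true : ∀ {b} → T b → b ≡ true
T⇒≡true {true} _ = refl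

anyF-intro : ∀ {n} (P : Fin n → Bool) i → T (P i) → T (anyF P)
anyF-intro P fz h with P fz
... | true = tt
anyF-intro P (fs i) h with P fz
... | true  = tt
... | false = anyF-intro (P ∘ fs) i h

anyF-witness : ∀ {n} (P : Fin n → Bool) → T (anyF P) → ∃ λ i → T (P i)
anyF-witness {suc n} P h with P fz in eq
... | true  = fz , T-subst (sym eq) tt
... | false = let i , p = anyF-witness (P ∘ fs) h in fs i , p

anyF-cong : ∀ {n} {P Q : Fin n → Bool} → (∀ i → P i ≡ Q i) → anyF P ≡ anyF Q
anyF-cong {zero}  e = refl
anyF-cong {suc n} e = cong₂ _∨_ (e fz) (anyF-cong (e ∘ fs))

indicator : Bool → ℕ
indicator b = if b then 1 else 0

countL-cong : ∀ {A : Set} (xs : List A) {P Q : A → Bool} → (∀ x → P x ≡ Q x) →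
              countL xs P ≡ countL xs Q
countL-cong []       e = refl
countL-cong (x ∷ xs) e = cong₂ (λ b c → indicator b + c) (e x) (countL-cong xs e)

countL-false : ∀ {A : Set} (xs : List A) → countL xs (λ _ → false) ≡ 0
countL-false []       = refl
countL-false (_ ∷ xs) = countL-false xs

countL-∧-gate : ∀ {A : Set} (xs : List A) a c (b d : A → Bool) →
  countL xs (λ x → (a ∧ b x) ∧ (c ∧ d x)) ≡ (if a ∧ c then countL xs (λ x → b x ∧ d x) else 0)
countL-∧-gate xs true  true  b d = refl
countL-∧-gate xs true  false b d = trans (countL-cong xs (λ x → ∧-zeroʳ (b x))) (countL-false xs)
countL-∧-gate xs false c     b d = countL-false xs

countL-witness : ∀ {A : Set} (xs : List A) (P : A → Bool) → 0 < countL xs P → ∃ λ x → T (P x)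
countL-witness (x ∷ xs) P h with P x in eq
... | true  = x , T-subst (sym eq) tt
... | false = countL-witness xs P h

∈⇒countL-pos : ∀ {A : Set} {xs : List A} (P : A → Bool) {x} → x ∈ xs → T (P x) → 0 < countL xs P
∈⇒countL-pos {xs = y ∷ _} P (here refl) h with P y
... | true = s≤s z≤n
∈⇒countL-pos {xs = y ∷ _} P (there x∈) h with P y
... | true  = s≤s z≤n
... | false = ∈⇒countL-pos P x∈ h

countL-++ : ∀ {A : Set} (xs ys : List A) P → countL (xs ++ ys) P ≡ countL xs P + countL ys P
countL-++ []       ys P = refl
countL-++ (x ∷ xs) ys P =
  trans (cong (indicator (P x) +_) (countL-++ xs ys P)) (sym (+-assoc (indicator (P x)) _ _))

countL-map : ∀ {A B : Set} (f : A → B) (xs : List A) P → countL (map f xs) P ≡ countL xs (P ∘ f)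
countL-map f []       P = refl
countL-map f (x ∷ xs) P = cong (indicator (P (f x)) +_) (countL-map f xs P)

countL-tabulate : ∀ {A : Set} {n} (f : Fin n → A) P →
                  countL (tabulate f) P ≡ sum (λ i → indicator (P (f i)))
countL-tabulate {n = zero}  f P = refl
countL-tabulate {n = suc n} f P = cong (indicator (P (f fz)) +_) (countL-tabulate (f ∘ fs) P)

countL-allFin : ∀ {n} P → countL (allFin n) P ≡ sum (λ i → indicator (P i))
countL-allFin = countL-tabulate id

countL-cartesianProduct : ∀ {A B : Set} {m} (f : Fin m → A) (xs : List B) P →
  countL (cartesianProduct (tabulate f) xs) P ≡ sum (λ i → countL xs (λ x → P (f i , x)))
countL-cartesianProduct {m = zero}  f xs P = refl
countL-cartesianProduct {m = suc m} f xs P =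
  trans (countL-++ (map (f fz ,_) xs) _ P)
        (cong₂ _+_ (countL-map (f fz ,_) xs P) (countL-cartesianProduct (f ∘ fs) xs P))

sum-single : ∀ {n} (t : Fin n → ℕ) i → (∀ j → ¬ j ≡ i → t j ≡ 0) → sum t ≡ t i
sum-single {suc n} t i vanish = begin
  sum t                                   ≡⟨ sum-remove t ⟩
  t i + sum (t ∘ punchIn i)               ≡⟨ cong (t i +_) (sum-cong-≗ λ j → vanish _ (punchInᵢ≢i i j)) ⟩
  t i + sum {n} (λ _ → 0)                 ≡⟨ cong (t i +_) (sum-replicate-zero n) ⟩
  t i + 0                                 ≡⟨ +-identityʳ (t i) ⟩
  t i                                     ∎
  where open ≡-Reasoning

sum-indicator-∧ : ∀ {n} c (P : Fin n → Bool) →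
                  sum (λ i → indicator (c ∧ P i)) ≡ (if c then sum (indicator ∘ P) else 0)
sum-indicator-∧ true  P = refl
sum-indicator-∧ {n} false P = sum-replicate-zero n

sum-indicator-* : ∀ {n} (c : Fin n → Bool) K →
                  sum (λ i → if c i then K else 0) ≡ sum (λ i → indicator (c i)) * K
sum-indicator-* {n} c K =
  sym (trans (*-distribʳ-sum K (indicator ∘ c)) (sum-cong-≗ {n} λ i → indicator-* (c i)))
  where
    indicator-* : ∀ b → indicator b * K ≡ (if b then K else 0)
    indicator-* true  = +-identityʳ K
    indicator-* false = refl

pairCount : ∀ {n r} → Scheme n r → (Fin r → Fin r → Bool) → Fin r → ℕ
pairCount S c k = sum λ i → sum λ j → if c i j then a S i j k else 0

pairCount-cong : ∀ {n n' r} {S : Scheme n r} {S' : Scheme n' r} {c c' : Fin r → Fin r → Bool} →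
                 (∀ i j k → a S i j k ≡ a S' i j k) → (∀ i j → c i j ≡ c' i j) →
                 ∀ k → pairCount S c k ≡ pairCount S' c' k
pairCount-cong a≡a' c≡c' k =
  sum-cong-≗ λ i → sum-cong-≗ λ j → cong₂ (if_then_else 0) (c≡c' i j) (a≡a' i j k)

module SchemeFacts {n r : ℕ} (S : Scheme n r) where
  open Scheme S

  relOf : Fin n → Fin n → Fin r
  relOf x y = proj₁ (cover x y)

  relOf-sound : ∀ x y → T (rel (relOf x y) x y)
  relOf-sound x y = proj₂ (cover x y)

  rel-unique : ∀ {i j x y} → T (rel i x y) → T (rel j x y) → i ≡ j
  rel-unique h h' = distinct _ _ (disjoint _ _ _ _ h h')

  relOf-unique : ∀ {i x y} → T (rel i x y) → relOf x y ≡ i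
  relOf-unique = rel-unique (relOf-sound _ _)

  rel-false : ∀ {i x y} → ¬ i ≡ relOf x y → rel i x y ≡ false
  rel-false {i} {x} {y} i≢ with rel i x y in eq
  ... | true  = ⊥-elim (i≢ (sym (relOf-unique (T-subst (sym eq) tt))))
  ... | false = refl

  source target : Fin r → Fin n
  source i = proj₁ (nonempty i)
  target i = proj₁ (proj₂ (nonempty i))

  rel-source-target : ∀ i → T (rel i (source i) (target i))
  rel-source-target i = proj₂ (proj₂ (nonempty i))

  rel-one-refl : ∀ x → T (rel (one S) x x)
  rel-one-refl x = from (proj₂ diagonal x x) refl

  rel-one⇒≡ : ∀ {x y} → T (rel (one S) x y) → x ≡ y
  rel-one⇒≡ = to (proj₂ diagonal _ _)

  relOf-refl : ∀ x → relOf x x ≡ one S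
  relOf-refl x = relOf-unique (rel-one-refl x)

  rel-star : ∀ p x y → rel (star S p) x y ≡ rel p y x
  rel-star p = proj₂ (transpose p)

  pathCount : Fin r → Fin r → Fin n → Fin n → ℕ
  pathCount p q x z = countL (allFin n) (λ y → rel p x y ∧ rel q y z)

  pathCount≡a : ∀ {p q k x z} → T (rel k x z) → pathCount p q x z ≡ a S p q k
  pathCount≡a {p} {q} {k} {x} {z} h =
    regular p q k x z (source k) (target k) h (rel-source-target k)

  path⇒pathCount-pos : ∀ {p q x y z} → T (rel p x y) → T (rel q y z) → 0 < pathCount p q x z
  path⇒pathCount-pos {p} {q} {x} hp hq =
    ∈⇒countL-pos (λ y → rel p x y ∧ rel q y _) (∈-allFin _) (∧-intro hp hq)

  pathCount-pos⇒path : ∀ {p q x z} → 0 < pathCount p q x z →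
                       ∃ λ y → T (rel p x y) × T (rel q y z)
  pathCount-pos⇒path {p} {q} {x} {z} h =
    let y , hy = countL-witness (allFin n) (λ y → rel p x y ∧ rel q y z) h
    in y , ∧-proj₁ hy , ∧-proj₂ hy

  path⇒a-pos : ∀ {p q k x y z} → T (rel k x z) → T (rel p x y) → T (rel q y z) → 0 < a S p q k
  path⇒a-pos hk hp hq = subst (0 <_) (pathCount≡a hk) (path⇒pathCount-pos hp hq)

  a-pos⇒path : ∀ {p q k x z} → T (rel k x z) → 0 < a S p q k →
               ∃ λ y → T (rel p x y) × T (rel q y z)
  a-pos⇒path hk pos = pathCount-pos⇒path (subst (0 <_) (sym (pathCount≡a hk)) pos)

  path-transfer : ∀ {p q k x y z x' z'} → T (rel k x z) → T (rel k x' z') →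
                  T (rel p x y) → T (rel q y z) → ∃ λ y' → T (rel p x' y') × T (rel q y' z')
  path-transfer hk hk' hp hq = a-pos⇒path hk' (path⇒a-pos hk hp hq)

  sum-over-rel : ∀ x y (t : Fin r → Bool → ℕ) → (∀ i → t i false ≡ 0) →
                 sum (λ i → t i (rel i x y)) ≡ t (relOf x y) true
  sum-over-rel x y t t-false =
    trans (sum-single _ (relOf x y) (λ i i≢ → trans (cong (t i) (rel-false i≢)) (t-false i)))
          (cong (t (relOf x y)) (T⇒≡true (relOf-sound x y)))

  countL-relOf-pair : ∀ (c : Fin r → Fin r → Bool) {k w w'} → T (rel k w w') →
    countL (allFin n) (λ x → c (relOf w x) (relOf x w')) ≡ pairCount S c k
  countL-relOf-pair c {k} {w} {w'} hk = begin
    countL (allFin n) (λ x → c (relOf w x) (relOf x w'))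
      ≡⟨ countL-allFin {n} _ ⟩
    sum (λ x → indicator (c (relOf w x) (relOf x w')))
      ≡⟨ sum-cong-≗ (λ x → sym (split x)) ⟩
    sum (λ x → sum λ i → sum λ j → term i j x)
      ≡⟨ ∑-comm (λ x i → sum λ j → term i j x) ⟩
    sum (λ i → sum λ x → sum λ j → term i j x)
      ≡⟨ sum-cong-≗ {r} (λ i → ∑-comm (λ x j → term i j x)) ⟩
    sum (λ i → sum λ j → sum λ x → term i j x)
      ≡⟨ sum-cong-≗ (λ i → sum-cong-≗ (λ j → count-ij i j)) ⟩
    pairCount S c k
      ∎
    where
      open ≡-Reasoning
      term : Fin r → Fin r → Fin n → ℕ
      term i j x = indicator (c i j ∧ (rel i w x ∧ rel j x w'))

      split : ∀ x → sum (λ i → sum λ j → term i j x) ≡ indicator (c (relOf w x) (relOf x w'))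
      split x = begin
        sum (λ i → sum λ j → term i j x)
          ≡⟨ sum-cong-≗ (λ i → sum-over-rel x w' (λ j b → indicator (c i j ∧ (rel i w x ∧ b)))
                                 (λ j → cong indicator (trans (cong (c i j ∧_) (∧-zeroʳ _)) (∧-zeroʳ _)))) ⟩
        sum (λ i → indicator (c i (relOf x w') ∧ (rel i w x ∧ true)))
          ≡⟨ sum-over-rel w x (λ i b → indicator (c i (relOf x w') ∧ (b ∧ true)))
                          (λ i → cong indicator (∧-zeroʳ _)) ⟩
        indicator (c (relOf w x) (relOf x w') ∧ true)
          ≡⟨ cong indicator (∧-identityʳ _) ⟩
        indicator (c (relOf w x) (relOf x w'))
          ∎

      count-ij : ∀ i j → sum (λ x → term i j x) ≡ (if c i j then a S i j k else 0)
      count-ij i j = begin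
        sum (λ x → term i j x)
          ≡⟨ sum-indicator-∧ (c i j) (λ x → rel i w x ∧ rel j x w') ⟩
        (if c i j then sum (λ x → indicator (rel i w x ∧ rel j x w')) else 0)
          ≡⟨ cong (if c i j then_else 0) (trans (sym (countL-allFin {n} _)) (pathCount≡a hk)) ⟩
        (if c i j then a S i j k else 0)
          ∎

-- Quotients by closed subsets

module _ {n r : ℕ} (S : Scheme n r) where

  QRelEq-refl : ∀ C {s} → QRelEq S C s s
  QRelEq-refl C x y = refl

  QRelEq-sym : ∀ C {s s'} → QRelEq S C s s' → QRelEq S C s' s
  QRelEq-sym C e x y = sym (e x y)

  QRelEq-trans : ∀ C {s s' s''} → QRelEq S C s s' → QRelEq S C s' s'' → QRelEq S C s s''
  QRelEq-trans C e e' x y = trans (e x y) (e' x y)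

  qrel-cong-subset : ∀ {C C'} → (∀ p → C p ≡ C' p) → ∀ s x y → qrel S C s x y ≡ qrel S C' s x y
  qrel-cong-subset C≡C' s x y =
    anyF-cong λ u → anyF-cong λ v →
      cong₂ (λ b b' → b ∧ b' ∧ Scheme.rel S s u v)
            (anyF-cong λ t → cong (_∧ Scheme.rel S t x u) (C≡C' t))
            (anyF-cong λ t → cong (_∧ Scheme.rel S t y v) (C≡C' t))

  QRelEq-cong-subset : ∀ {C C'} → (∀ p → C p ≡ C' p) → ∀ {s s'} → QRelEq S C s s' → QRelEq S C' s s'
  QRelEq-cong-subset C≡C' {s} {s'} e x y =
    trans (sym (qrel-cong-subset C≡C' s x y)) (trans (e x y) (qrel-cong-subset C≡C' s' x y))

module ClosedSubset {n r : ℕ} (S : Scheme n r) (C : Fin r → Bool) (C-closed : IsClosed S C) where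
  open Scheme S
  open SchemeFacts S
  open IsClosed C-closed

  infix 4 _∼_
  _∼_ : Fin n → Fin n → Set
  x ∼ y = T (C (relOf x y))

  ∼-fork : ∀ {p q x y z} → T (C p) → T (C q) → T (rel p x y) → T (rel q x z) → y ∼ z
  ∼-fork {p} {q} {x} {y} {z} Cp Cq hp hq =
    closed p q (relOf y z) Cp Cq
      (path⇒a-pos (relOf-sound y z) (T-subst (sym (rel-star p y x)) hp) hq)

  C-one : T (C (one S))
  C-one = let p , Cp = inhabited in
          subst (T ∘ C) (relOf-refl (target p))
                (∼-fork Cp Cp (rel-source-target p) (rel-source-target p))

  rel⇒∼ : ∀ {p x y} → T (C p) → T (rel p x y) → x ∼ y
  rel⇒∼ Cp h = subst (T ∘ C) (sym (relOf-unique h)) Cp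

  ∼-refl : ∀ {x} → x ∼ x
  ∼-refl {x} = rel⇒∼ C-one (rel-one-refl x)

  ∼-sym : ∀ {x y} → x ∼ y → y ∼ x
  ∼-sym {x} {y} c = ∼-fork c C-one (relOf-sound x y) (rel-one-refl x)

  ∼-trans : ∀ {x y z} → x ∼ y → y ∼ z → x ∼ z
  ∼-trans {x} {y} {z} c c' = ∼-fork (∼-sym c) c' (relOf-sound y x) (relOf-sound y z)

  inCoset⇔∼ : ∀ {x y} → T (inCoset S C x y) ⇔ x ∼ y
  inCoset⇔∼ {x} {y} = mk⇔
    (λ h → let t , ht = anyF-witness (λ t → C t ∧ rel t x y) h in rel⇒∼ (∧-proj₁ ht) (∧-proj₂ ht))
    (λ c → anyF-intro (λ t → C t ∧ rel t x y) (relOf x y) (∧-intro c (relOf-sound x y)))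

  CosetEq⇔∼ : ∀ {x x'} → CosetEq S C x x' ⇔ x ∼ x'
  CosetEq⇔∼ {x} {x'} = mk⇔
    (λ e → to inCoset⇔∼ (T-subst (sym (e x')) (from inCoset⇔∼ ∼-refl)))
    (λ c y → T-ext (λ h → from inCoset⇔∼ (∼-trans (∼-sym c) (to inCoset⇔∼ h)))
                   (λ h → from inCoset⇔∼ (∼-trans c (to inCoset⇔∼ h))))

  qrel-intro : ∀ {s x₁ x₂ u v} → x₁ ∼ u → x₂ ∼ v → T (rel s u v) → T (qrel S C s x₁ x₂)
  qrel-intro {s} {x₁} {x₂} {u} {v} c₁ c₂ h =
    anyF-intro _ u (anyF-intro (λ v → inCoset S C x₁ u ∧ inCoset S C x₂ v ∧ rel s u v) v
      (∧-intro (from inCoset⇔∼ c₁) (∧-intro (from inCoset⇔∼ c₂) h)))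

  qrel-elim : ∀ {s x₁ x₂} → T (qrel S C s x₁ x₂) →
              ∃₂ λ u v → x₁ ∼ u × x₂ ∼ v × T (rel s u v)
  qrel-elim {s} {x₁} {x₂} h =
    let u , hu = anyF-witness _ h
        v , hv = anyF-witness (λ v → inCoset S C x₁ u ∧ inCoset S C x₂ v ∧ rel s u v) hu
        hv′ = ∧-proj₂ {inCoset S C x₁ u} hv
    in u , v , to inCoset⇔∼ (∧-proj₁ hv) , to inCoset⇔∼ (∧-proj₁ hv′) ,
       ∧-proj₂ {inCoset S C x₂ v} hv′

  rel⇒qrel : ∀ {s x y} → T (rel s x y) → T (qrel S C s x y)
  rel⇒qrel = qrel-intro ∼-refl ∼-refl

  qrel-cong : ∀ {s x₁ x₂ x₁' x₂'} → x₁ ∼ x₁' → x₂ ∼ x₂' →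
              qrel S C s x₁ x₂ ≡ qrel S C s x₁' x₂'
  qrel-cong c₁ c₂ = T-ext (move c₁ c₂) (move (∼-sym c₁) (∼-sym c₂))
    where
      move : ∀ {s x₁ x₂ x₁' x₂'} → x₁ ∼ x₁' → x₂ ∼ x₂' →
             T (qrel S C s x₁ x₂) → T (qrel S C s x₁' x₂')
      move c₁ c₂ h = let u , v , c₁u , c₂v , huv = qrel-elim h in
        qrel-intro (∼-trans (∼-sym c₁) c₁u) (∼-trans (∼-sym c₂) c₂v) huv

  -- The coset shifts relating an s-witness and an s'-witness over (x₁, x₂) are
  -- replayed at any other s-witness, using the regularity of S twice.
  qrel-disjoint : ∀ {s s' x₁ x₂} → T (qrel S C s x₁ x₂) → T (qrel S C s' x₁ x₂) → QRelEq S C s s'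
  qrel-disjoint h h' y₁ y₂ = T-ext (replay h h') (replay h' h)
    where
      replay : ∀ {s s' x₁ x₂} → T (qrel S C s x₁ x₂) → T (qrel S C s' x₁ x₂) →
               T (qrel S C s y₁ y₂) → T (qrel S C s' y₁ y₂)
      replay h h' hy =
        let u  , v  , c₁u  , c₂v  , huv   = qrel-elim h
            u' , v' , c₁u' , c₂v' , huv'  = qrel-elim h'
            p  , q  , c₁p  , c₂q  , hpq   = qrel-elim hy
            q' , hpq' , hq'q = path-transfer huv hpq (relOf-sound u v') (relOf-sound v' v)
            p' , hpp' , hp'q' = path-transfer (relOf-sound u v') hpq' (relOf-sound u u') huv'
        in qrel-intro (∼-trans c₁p (rel⇒∼ (∼-trans (∼-sym c₁u) c₁u') hpp'))
                      (∼-trans c₂q (∼-sym (rel⇒∼ (∼-trans (∼-sym c₂v') c₂v) hq'q)))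
                      hp'q'

  qrel-star : ∀ {s x y} → qrel S C (star S s) x y ≡ qrel S C s y x
  qrel-star {s} = T-ext
    (λ h → let u , v , cu , cv , huv = qrel-elim h in qrel-intro cv cu (T-subst (rel-star s u v) huv))
    (λ h → let u , v , cu , cv , huv = qrel-elim h in qrel-intro cv cu (T-subst (sym (rel-star s v u)) huv))

  QRelEq-one⇔ : ∀ {s} → QRelEq S C s (one S) ⇔ T (C s)
  QRelEq-one⇔ {s} = mk⇔
    (λ e → let u , v , cu , cv , huv =
                 qrel-elim (T-subst (e (source s) (target s)) (rel⇒qrel (rel-source-target s)))
           in subst (T ∘ C) (relOf-unique (rel-source-target s))
                    (∼-trans cu (subst (_∼ target s) (sym (rel-one⇒≡ huv)) (∼-sym cv))))
    (λ Cs → qrel-disjoint (rel⇒qrel (rel-source-target s))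
                          (qrel-intro (rel⇒∼ Cs (rel-source-target s)) ∼-refl (rel-one-refl (target s))))

  sameClass : Fin r → Fin r → Bool
  sameClass s i = qrel S C s (source i) (target i)

  T-sameClass⇔ : ∀ {s i} → T (sameClass s i) ⇔ QRelEq S C s i
  T-sameClass⇔ {s} {i} = mk⇔
    (λ h → qrel-disjoint h (rel⇒qrel (rel-source-target i)))
    (λ e → T-subst (sym (e (source i) (target i))) (rel⇒qrel (rel-source-target i)))

  sameClass-relOf : ∀ s x y → sameClass s (relOf x y) ≡ qrel S C s x y
  sameClass-relOf s x y = T-ext
    (λ h → T-subst (sym (to T-sameClass⇔ h x y)) (rel⇒qrel (relOf-sound x y)))
    (λ h → from T-sameClass⇔ (qrel-disjoint h (rel⇒qrel (relOf-sound x y))))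

  module Normal (C-normal : IsNormal S C) where

    normal-left : ∀ {w₁ w w'} → w₁ ∼ w → ∃ λ z → z ∼ w' × relOf w₁ z ≡ relOf w w'
    normal-left {w₁} {w} {w'} c =
      let t , Ct , pos = from (C-normal (relOf w w') (relOf w₁ w'))
                           (relOf w₁ w , c ,
                            path⇒a-pos (relOf-sound w₁ w') (relOf-sound w₁ w) (relOf-sound w w'))
          z , h₁ , h₂ = a-pos⇒path (relOf-sound w₁ w') pos
      in z , rel⇒∼ Ct h₂ , relOf-unique h₁

    normal-right : ∀ {w w' w₁'} → w' ∼ w₁' → ∃ λ z → w ∼ z × relOf z w₁' ≡ relOf w w'
    normal-right {w} {w'} {w₁'} c =
      let t , Ct , pos = to (C-normal (relOf w w') (relOf w w₁'))
                           (relOf w' w₁' , c ,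
                            path⇒a-pos (relOf-sound w w₁') (relOf-sound w w') (relOf-sound w' w₁'))
          z , h₁ , h₂ = a-pos⇒path (relOf-sound w w₁') pos
      in z , rel⇒∼ Ct h₁ , relOf-unique h₂

-- Counting two-step paths through two normal closed subsets

module TwoStepCount {n r : ℕ} (Z : Scheme n r)
  (B : Fin r → Bool) (B-closed : IsClosed Z B) (B-normal : IsNormal Z B)
  (A : Fin r → Bool) (A-closed : IsClosed Z A) (A-normal : IsNormal Z A) where
  open Scheme Z
  open SchemeFacts Z
  module CB = ClosedSubset Z B B-closed
  module CA = ClosedSubset Z A A-closed
  private
    module NB = CB.Normal B-normal
    module NA = CA.Normal A-normal

  infixr 5 _∷ᴬ_ _∷ᴮ_
  data Linked : Fin n → Fin n → Set where
    []   : ∀ {x} → Linked x x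
    _∷ᴬ_ : ∀ {x y z} → x CA.∼ y → Linked y z → Linked x z
    _∷ᴮ_ : ∀ {x y z} → x CB.∼ y → Linked y z → Linked x z

  Linked-trans : ∀ {x y z} → Linked x y → Linked y z → Linked x z
  Linked-trans []       l' = l'
  Linked-trans (c ∷ᴬ l) l' = c ∷ᴬ Linked-trans l l'
  Linked-trans (c ∷ᴮ l) l' = c ∷ᴮ Linked-trans l l'

  module _ (t s : Fin r) where

    twoStepCount : Fin n → Fin n → ℕ
    twoStepCount w w' = countL (allFin n) (λ x → qrel Z B t w x ∧ qrel Z A s x w')

    twoStepCount≡pairCount : ∀ {k w w'} → T (rel k w w') →
      twoStepCount w w' ≡ pairCount Z (λ i j → CB.sameClass t i ∧ CA.sameClass s j) k
    twoStepCount≡pairCount {w = w} {w'} hk =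
      trans (countL-cong (allFin n) λ x →
               sym (cong₂ _∧_ (CB.sameClass-relOf t w x) (CA.sameClass-relOf s x w')))
            (countL-relOf-pair _ hk)

    twoStepCount-relOf : ∀ {w w' v v'} → relOf w w' ≡ relOf v v' →
                         twoStepCount w w' ≡ twoStepCount v v'
    twoStepCount-relOf {w} {w'} {v} {v'} e =
      trans (twoStepCount≡pairCount (relOf-sound w w'))
            (sym (twoStepCount≡pairCount (subst (λ k → T (rel k v v')) (sym e) (relOf-sound v v'))))

    B-moveˡ : ∀ {w w₁ w'} → w CB.∼ w₁ → twoStepCount w w' ≡ twoStepCount w₁ w'
    B-moveˡ c = countL-cong (allFin n) λ x → cong (_∧ _) (CB.qrel-cong c CB.∼-refl)

    A-moveʳ : ∀ {w w' w₁'} → w' CA.∼ w₁' → twoStepCount w w' ≡ twoStepCount w w₁'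
    A-moveʳ c = countL-cong (allFin n) λ x → cong (_ ∧_) (CA.qrel-cong CA.∼-refl c)

    A-moveˡ : ∀ {w w₁ w'} → w CA.∼ w₁ → twoStepCount w w' ≡ twoStepCount w₁ w'
    A-moveˡ c = let z , z∼w' , e = NA.normal-left (CA.∼-sym c) in
      sym (trans (A-moveʳ (CA.∼-sym z∼w')) (twoStepCount-relOf e))

    B-moveʳ : ∀ {w w' w₁'} → w' CB.∼ w₁' → twoStepCount w w' ≡ twoStepCount w w₁'
    B-moveʳ c = let z , w∼z , e = NB.normal-right c in
      sym (trans (B-moveˡ w∼z) (twoStepCount-relOf e))

    Linked-moveˡ : ∀ {w w₁ w'} → Linked w w₁ → twoStepCount w w' ≡ twoStepCount w₁ w'
    Linked-moveˡ []       = refl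
    Linked-moveˡ (c ∷ᴬ l) = trans (A-moveˡ c) (Linked-moveˡ l)
    Linked-moveˡ (c ∷ᴮ l) = trans (B-moveˡ c) (Linked-moveˡ l)

    Linked-moveʳ : ∀ {w w' w₁'} → Linked w' w₁' → twoStepCount w w' ≡ twoStepCount w w₁'
    Linked-moveʳ []       = refl
    Linked-moveʳ (c ∷ᴬ l) = trans (A-moveʳ c) (Linked-moveʳ l)
    Linked-moveʳ (c ∷ᴮ l) = trans (B-moveʳ c) (Linked-moveʳ l)

module HomFacts {n m r r'} {x* : Fin n} {y* : Fin m} {S : Scheme n r} {S' : Scheme m r'}
                (φ : Hom x* y* S S') where
  open Hom φ
  open SchemeFacts S
  private
    module Src = ClosedSubset S C₁ C₁-closed
    module Tgt = ClosedSubset S' C₂ C₂-closed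

  qrel-g-f : ∀ s x₁ x₂ → qrel S' C₂ (g s) (f x₁) (f x₂) ≡ qrel S C₁ s x₁ x₂
  qrel-g-f s x₁ x₂ = T-ext
    (λ h → let e = g-inj s (relOf x₁ x₂)
                     (Tgt.qrel-disjoint h (g-hom _ x₁ x₂ (Src.rel⇒qrel (relOf-sound x₁ x₂))))
           in T-subst (sym (e x₁ x₂)) (Src.rel⇒qrel (relOf-sound x₁ x₂)))
    (g-hom s x₁ x₂)

  g-cong : ∀ {s s'} → QRelEq S C₁ s s' → QRelEq S' C₂ (g s) (g s')
  g-cong {s} e = Tgt.qrel-disjoint
    (g-hom s _ _ (Src.rel⇒qrel (rel-source-target s)))
    (g-hom _ _ _ (T-subst (e (source s) (target s)) (Src.rel⇒qrel (rel-source-target s))))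

  g-one : QRelEq S' C₂ (g (one S)) (one S')
  g-one = Tgt.qrel-disjoint (g-hom (one S) x* x* (Src.rel⇒qrel (rel-one-refl x*)))
                            (Tgt.rel⇒qrel (SchemeFacts.rel-one-refl S' (f x*)))

g-dual-inverse : ∀ {n m r r'} {x* : Fin n} {y* : Fin m} {S : Scheme n r} {S' : Scheme m r'}
                 (φ : Hom x* y* S S') (ψ : Hom y* x* S' S) → IsDualHom ψ φ →
                 ∀ s → QRelEq S' (Hom.C₂ φ) (Hom.g φ (Hom.g ψ s)) s
g-dual-inverse {S = S} {S'} φ ψ (_ , C₂ψ≡C₁φ , _ , fφfψ∼) s =
  Tgt.qrel-disjoint
    (T-subst (Tgt.qrel-cong (round p) (round q))
      (Hom.g-hom φ _ _ _
        (T-subst (qrel-cong-subset S C₂ψ≡C₁φ _ _ _)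
          (Hom.g-hom ψ s p q
            (ClosedSubset.rel⇒qrel S' (Hom.C₁ ψ) (Hom.C₁-closed ψ) (rel-source-target s))))))
    (Tgt.rel⇒qrel (rel-source-target s))
  where
    open SchemeFacts S'
    module Tgt = ClosedSubset S' (Hom.C₂ φ) (Hom.C₂-closed φ)
    p = source s
    q = target s
    round : ∀ y → Hom.f φ (Hom.f ψ y) Tgt.∼ y
    round y = to Tgt.CosetEq⇔∼ (fφfψ∼ y)

-- Actions

module ActionFacts {n m r ru} {x* : Fin n} {S : Scheme n r} {y* : Fin m} {U : Scheme m ru}
                   (A : Action x* S y* U) where
  open Action A

  C″ : Fin m → Fin m → Fin r → Bool
  C″ y₁ y₂ = Hom.C₂ (ζ y₁ y₂)

  fζ : Fin m → Fin m → Fin n → Fin n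
  fζ y₁ y₂ = Hom.f (ζ y₁ y₂)

  gζ : Fin m → Fin m → Fin r → Fin r
  gζ y₁ y₂ = Hom.g (ζ y₁ y₂)

  module Fibre (y₁ y₂ : Fin m) = ClosedSubset (Sy y₂) (C″ y₁ y₂) (Hom.C₂-closed (ζ y₁ y₂))

  _∈U_ : Fin ru → Fin m × Fin m → Set
  u ∈U (y₁ , y₂) = T (Scheme.rel U u y₁ y₂)

  ∈U-transpose : ∀ {u y y'} → u ∈U (y , y') → star U u ∈U (y' , y)
  ∈U-transpose {u} = T-subst (sym (SchemeFacts.rel-star U u _ _))

  star-Sy : ∀ y p → star (Sy y) p ≡ star S p
  star-Sy y p = Scheme.distinct (Sy y) _ _ λ x z →
    trans (SchemeFacts.rel-star (Sy y) p x z) (sym (IsTauScheme.star-pres (tau y) p x z))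

  C″-dual : ∀ y₁ y₂ p → C″ y₂ y₁ p ≡ Hom.C₁ (ζ y₁ y₂) p
  C″-dual y₁ y₂ = proj₁ (proj₂ (ζ-dual y₁ y₂))

  f-roundtrip : ∀ y₁ y₂ x → Fibre._∼_ y₁ y₂ (fζ y₁ y₂ (fζ y₂ y₁ x)) x
  f-roundtrip y₁ y₂ x = to (Fibre.CosetEq⇔∼ y₁ y₂) (proj₂ (proj₂ (proj₂ (ζ-dual y₁ y₂))) x)

  g-roundtrip : ∀ y₁ y₂ s → QRelEq (Sy y₂) (C″ y₁ y₂) (gζ y₁ y₂ (gζ y₂ y₁ s)) s
  g-roundtrip y₁ y₂ = g-dual-inverse (ζ y₁ y₂) (ζ y₂ y₁) (ζ-dual y₁ y₂)

  g-cong : ∀ y₁ y₂ {s s'} → QRelEq (Sy y₁) (C″ y₂ y₁) s s' →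
           QRelEq (Sy y₂) (C″ y₁ y₂) (gζ y₁ y₂ s) (gζ y₁ y₂ s')
  g-cong y₁ y₂ e = HomFacts.g-cong (ζ y₁ y₂) (QRelEq-cong-subset (Sy y₁) (C″-dual y₁ y₂) e)

  qrel-transport : ∀ y₁ y₂ t x₁ x₂ →
    qrel (Sy y₂) (C″ y₁ y₂) (gζ y₁ y₂ t) (fζ y₁ y₂ x₁) (fζ y₁ y₂ x₂)
      ≡ qrel (Sy y₁) (C″ y₂ y₁) t x₁ x₂
  qrel-transport y₁ y₂ t x₁ x₂ =
    trans (HomFacts.qrel-g-f (ζ y₁ y₂) t x₁ x₂)
          (sym (qrel-cong-subset (Sy y₁) (C″-dual y₁ y₂) t x₁ x₂))

  g-class-invariant : ∀ {u y₁ y₂ y₁' y₂' t i} → u ∈U (y₁ , y₂) → u ∈U (y₁' , y₂') →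
    QRelEq (Sy y₂) (C″ y₁ y₂) (gζ y₁ y₂ t) i → QRelEq (Sy y₂') (C″ y₁' y₂') (gζ y₁' y₂' t) i
  g-class-invariant {u} {y₁} {y₂} {y₁'} {y₂'} {t} {i} h h' e =
    let t₀ , t₀≡t , e₀ = to (ζ-tau u y₁ y₂ y₁' y₂' h h' (λ p → ⌊ p ≟ t ⌋) i)
                            (t , fromWitness refl , e)
    in subst (λ p → QRelEq (Sy y₂') (C″ y₁' y₂') (gζ y₁' y₂' p) i) (toWitness t₀≡t) e₀

  g-invariant : ∀ {u y₁ y₂ y₁' y₂' t} → u ∈U (y₁ , y₂) → u ∈U (y₁' , y₂') →
    QRelEq (Sy y₂) (C″ y₁ y₂) (gζ y₁ y₂ t) (gζ y₁' y₂' t)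
  g-invariant {y₁' = y₁'} {y₂'} h h' = g-class-invariant h' h (QRelEq-refl (Sy y₂') (C″ y₁' y₂'))

  pulledBackClass : Fin m → Fin m → Fin r → Fin r → Bool
  pulledBackClass y₁ y₂ t = Fibre.sameClass y₂ y₁ (gζ y₂ y₁ t)

  QRelEq⇔ApplyTau : ∀ y₁ y₂ {t t'} →
    QRelEq (Sy y₂) (C″ y₁ y₂) t t' ⇔ ApplyTau (ζ y₁ y₂) (pulledBackClass y₁ y₂ t) t'
  QRelEq⇔ApplyTau y₁ y₂ {t} = mk⇔
    (λ e → gζ y₂ y₁ t , from (Fibre.T-sameClass⇔ y₂ y₁) (QRelEq-refl (Sy y₁) (C″ y₂ y₁)) ,
           QRelEq-trans (Sy y₂) (C″ y₁ y₂) (g-roundtrip y₁ y₂ t) e)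
    (λ (p , hp , e) → QRelEq-trans (Sy y₂) (C″ y₁ y₂)
       (QRelEq-trans (Sy y₂) (C″ y₁ y₂) (QRelEq-sym (Sy y₂) (C″ y₁ y₂) (g-roundtrip y₁ y₂ t))
                                        (g-cong y₁ y₂ (to (Fibre.T-sameClass⇔ y₂ y₁) hp)))
       e)

  -- Both the pulled-back class (by g-class-invariant at the transposed pairs)
  -- and ζ(τ) (by axiom (4)) depend on the fibre pair only through u.
  QRelEq-invariant : ∀ {u y₁ y₂ y₁' y₂' t t'} → u ∈U (y₁ , y₂) → u ∈U (y₁' , y₂') →
    QRelEq (Sy y₂) (C″ y₁ y₂) t t' → QRelEq (Sy y₂') (C″ y₁' y₂') t t'
  QRelEq-invariant {u} {y₁} {y₂} {y₁'} {y₂'} {t} {t'} h h' e =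
    let p , hp , e' = to (QRelEq⇔ApplyTau y₁ y₂) e
        hp' = from (Fibre.T-sameClass⇔ y₂' y₁')
                (g-class-invariant (∈U-transpose h) (∈U-transpose h') (to (Fibre.T-sameClass⇔ y₂ y₁) hp))
    in from (QRelEq⇔ApplyTau y₁' y₂') (to (ζ-tau u y₁ y₂ y₁' y₂' h h' _ t') (p , hp' , e'))

  sameClass-invariant : ∀ {u y₁ y₂ y₁' y₂'} → u ∈U (y₁ , y₂) → u ∈U (y₁' , y₂') →
    ∀ t i → Fibre.sameClass y₁ y₂ t i ≡ Fibre.sameClass y₁' y₂' t i
  sameClass-invariant h h' t i = T-ext
    (λ c → from (Fibre.T-sameClass⇔ _ _) (QRelEq-invariant h h' (to (Fibre.T-sameClass⇔ _ _) c)))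
    (λ c → from (Fibre.T-sameClass⇔ _ _) (QRelEq-invariant h' h (to (Fibre.T-sameClass⇔ _ _) c)))

  sameClass-g-invariant : ∀ {u y₁ y₂ y₁' y₂'} → u ∈U (y₁ , y₂) → u ∈U (y₁' , y₂') →
    ∀ t i → Fibre.sameClass y₁ y₂ (gζ y₁ y₂ t) i ≡ Fibre.sameClass y₁' y₂' (gζ y₁' y₂' t) i
  sameClass-g-invariant h h' t i = T-ext
    (λ c → from (Fibre.T-sameClass⇔ _ _) (g-class-invariant h h' (to (Fibre.T-sameClass⇔ _ _) c)))
    (λ c → from (Fibre.T-sameClass⇔ _ _) (g-class-invariant h' h (to (Fibre.T-sameClass⇔ _ _) c)))

-- The semidirect product

module SemidirectProduct {n m r ru} {x* : Fin n} {S : Scheme n r} {y* : Fin m} {U : Scheme m ru}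
                         (A : Action x* S y* U) where
  open Action A
  open ActionFacts A
  private
    module Uf = SchemeFacts U
    module Sf (y : Fin m) = SchemeFacts (Sy y)

  R : Fin ru × Fin r → Rel (Fin m × Fin n)
  R = semidirect A

  R-pathCount : Fin ru × Fin r → Fin ru × Fin r → Fin m × Fin n → Fin m × Fin n → ℕ
  R-pathCount i j p q = countL (cartesianProduct (allFin m) (allFin n)) (λ z → R i p z ∧ R j z q)

  nonempty : ∀ i → Σ (Fin m × Fin n) λ p → Σ (Fin m × Fin n) λ q → T (R i p q)
  nonempty (u , t) =
    let y₁ = Uf.source u
        y₂ = Uf.target u
        x₁ , fx₁∼ = Hom.f-surj (ζ y₁ y₂) (Sf.source y₂ t)
    in (y₁ , x₁) , (y₂ , Sf.target y₂ t) ,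
       ∧-intro (Uf.rel-source-target u)
               (Fibre.qrel-intro y₁ y₂ (to (Fibre.CosetEq⇔∼ y₁ y₂) fx₁∼) (Fibre.∼-refl y₁ y₂)
                                 (Sf.rel-source-target y₂ t))

  cover : ∀ p q → Σ (Fin ru × Fin r) λ i → T (R i p q)
  cover (y₁ , x₁) (y₂ , x₂) =
    (Uf.relOf y₁ y₂ , Sf.relOf y₂ (fζ y₁ y₂ x₁) x₂) ,
    ∧-intro (Uf.relOf-sound y₁ y₂) (Fibre.rel⇒qrel y₁ y₂ (Sf.relOf-sound y₂ _ x₂))

  disjoint : ∀ i j p q → T (R i p q) → T (R j p q) → SameRel R i j
  disjoint (u , t) (u' , t') (y₁ , x₁) (y₂ , x₂) h h' =
    subst (λ v → SameRel R (u , t) (v , t')) (Uf.rel-unique (∧-proj₁ h) (∧-proj₁ h'))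
      λ { (z₁ , a₁) (z₂ , a₂) → ∧-cong-gated refl λ hz →
            QRelEq-invariant (∧-proj₁ h) hz
              (Fibre.qrel-disjoint y₁ y₂ (∧-proj₂ {Scheme.rel U u y₁ y₂} h)
                                         (∧-proj₂ {Scheme.rel U u' y₁ y₂} h'))
              (fζ z₁ z₂ a₁) a₂ }

  ∼-diagonal⇒≡ : ∀ y {x x'} → Fibre._∼_ y y x x' → x ≡ x'
  ∼-diagonal⇒≡ y {x} {x'} c =
    Sf.rel-one⇒≡ y (subst (λ k → T (Scheme.rel (Sy y) k x x')) (to (proj₁ (proj₂ (ζ-id y)) _) c)
                          (Sf.relOf-sound y x x'))

  f-diagonal : ∀ y x → Fibre._∼_ y y (fζ y y x) x
  f-diagonal y x = to (Fibre.CosetEq⇔∼ y y) (proj₂ (proj₂ (ζ-id y)) x)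

  diagonal : Σ (Fin ru × Fin r) λ i → ∀ p q → T (R i p q) ⇔ (p ≡ q)
  diagonal = (one U , one S) , λ { (y₁ , x₁) (y₂ , x₂) →
    mk⇔ (diagonal⇒≡ x₁ x₂) λ { refl → refl⇒diagonal y₁ x₁ } }
    where
      diagonal⇒≡ : ∀ {y₁ y₂} x₁ x₂ → T (R (one U , one S) (y₁ , x₁) (y₂ , x₂)) →
                   (y₁ , x₁) ≡ (y₂ , x₂)
      diagonal⇒≡ {y₁} x₁ x₂ h with Uf.rel-one⇒≡ (∧-proj₁ h)
      ... | refl =
        let u , v , fx₁∼u , x₂∼v , huv =
              Fibre.qrel-elim y₁ y₁ (∧-proj₂ {Scheme.rel U (one U) y₁ y₁} h)
            x₁≡u = ∼-diagonal⇒≡ y₁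
                     (Fibre.∼-trans y₁ y₁ (Fibre.∼-sym y₁ y₁ (f-diagonal y₁ x₁)) fx₁∼u)
            u≡v  = to (IsTauScheme.one-diag (tau y₁) u v) huv
            x₂≡v = ∼-diagonal⇒≡ y₁ x₂∼v
        in cong (y₁ ,_) (trans x₁≡u (trans u≡v (sym x₂≡v)))

      refl⇒diagonal : ∀ y x → T (R (one U , one S) (y , x) (y , x))
      refl⇒diagonal y x = ∧-intro (Uf.rel-one-refl y)
        (Fibre.qrel-intro y y (f-diagonal y x) (Fibre.∼-refl y y) (from (IsTauScheme.one-diag (tau y) x x) refl))

  -- The transpose of [u, t] is [u*, (t ζ̃)*] with ζ̃ taken at any pair in u*;
  -- by axiom (4) the choice of pair is irrelevant.
  transposeIndex : Fin ru × Fin r → Fin ru × Fin r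
  transposeIndex (u , t) = star U u , star S (gζ (Uf.source (star U u)) (Uf.target (star U u)) t)

  transpose : ∀ i → Σ (Fin ru × Fin r) λ j → ∀ p q → R j p q ≡ R i q p
  transpose (u , t) = transposeIndex (u , t) , λ { (y₁ , x₁) (y₂ , x₂) →
    ∧-cong-gated (Uf.rel-star u y₁ y₂) (fibre-transpose x₁ x₂) }
    where
      r₁ = Uf.source (star U u)
      r₂ = Uf.target (star U u)
      open ≡-Reasoning
      fibre-transpose : ∀ {y₁ y₂} x₁ x₂ → star U u ∈U (y₁ , y₂) →
        qrel (Sy y₂) (C″ y₁ y₂) (star S (gζ r₁ r₂ t)) (fζ y₁ y₂ x₁) x₂
          ≡ qrel (Sy y₁) (C″ y₂ y₁) t (fζ y₂ y₁ x₂) x₁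
      fibre-transpose {y₁} {y₂} x₁ x₂ h = begin
        qrel (Sy y₂) (C″ y₁ y₂) (star S (gζ r₁ r₂ t)) (fζ y₁ y₂ x₁) x₂
          ≡⟨ cong (λ s → qrel (Sy y₂) (C″ y₁ y₂) s (fζ y₁ y₂ x₁) x₂) (sym (star-Sy y₂ _)) ⟩
        qrel (Sy y₂) (C″ y₁ y₂) (star (Sy y₂) (gζ r₁ r₂ t)) (fζ y₁ y₂ x₁) x₂
          ≡⟨ Fibre.qrel-star y₁ y₂ ⟩
        qrel (Sy y₂) (C″ y₁ y₂) (gζ r₁ r₂ t) x₂ (fζ y₁ y₂ x₁)
          ≡⟨ sym (g-invariant h (Uf.rel-source-target (star U u)) x₂ (fζ y₁ y₂ x₁)) ⟩
        qrel (Sy y₂) (C″ y₁ y₂) (gζ y₁ y₂ t) x₂ (fζ y₁ y₂ x₁)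
          ≡⟨ Fibre.qrel-cong y₁ y₂ (Fibre.∼-sym y₁ y₂ (f-roundtrip y₁ y₂ x₂))
                                   (Fibre.∼-refl y₁ y₂) ⟩
        qrel (Sy y₂) (C″ y₁ y₂) (gζ y₁ y₂ t) (fζ y₁ y₂ (fζ y₂ y₁ x₂)) (fζ y₁ y₂ x₁)
          ≡⟨ qrel-transport y₁ y₂ t _ _ ⟩
        qrel (Sy y₁) (C″ y₂ y₁) t (fζ y₂ y₁ x₂) x₁
          ∎

  module Triangle (y₁ y₂ y₃ : Fin m) where
    open TwoStepCount (Sy y₂) (C″ y₁ y₂) (Hom.C₂-closed (ζ y₁ y₂)) (Hom.C₂-normal (ζ y₁ y₂))
                              (C″ y₃ y₂) (Hom.C₂-closed (ζ y₃ y₂)) (Hom.C₂-normal (ζ y₃ y₂)) public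

    -- Pulled back to T_{y₂}, the subset V of the composite ζ_{y₁y₂} ζ_{y₂y₃} lies in A B A.
    compositeKernel-linked : ∀ {v p q} → CompC₂ (ζ y₁ y₂) (ζ y₂ y₃) v →
                             T (Scheme.rel (Sy y₃) v p q) →
                             Linked (fζ y₃ y₂ p) (fζ y₃ y₂ q)
    compositeKernel-linked {v} {p} {q} (u₀ , g₁₂-one≡u₀ , g₂₃u₀≡v) hv =
      let u₀∈B = to CB.QRelEq-one⇔
                   (QRelEq-trans (Sy y₂) (C″ y₁ y₂) (QRelEq-sym (Sy y₂) (C″ y₁ y₂) g₁₂-one≡u₀)
                                 (HomFacts.g-one (ζ y₁ y₂)))
          g₃₂v≡u₀ = QRelEq-trans (Sy y₂) (C″ y₃ y₂)
                      (g-cong y₃ y₂ (QRelEq-sym (Sy y₃) (C″ y₂ y₃) g₂₃u₀≡v))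
                      (g-roundtrip y₃ y₂ u₀)
          hq = Hom.g-hom (ζ y₃ y₂) v p q
                 (ClosedSubset.rel⇒qrel (Sy y₃) (Hom.C₁ (ζ y₃ y₂)) (Hom.C₁-closed (ζ y₃ y₂)) hv)
          p̃ , q̃ , cp , cq , hp̃q̃ = CA.qrel-elim (T-subst (g₃₂v≡u₀ _ _) hq)
      in cp ∷ᴬ CB.rel⇒∼ u₀∈B hp̃q̃ ∷ᴮ CA.∼-sym cq ∷ᴬ []

    ∼₁₃-linked : ∀ {p q} → Fibre._∼_ y₁ y₃ p q → Linked (fζ y₃ y₂ p) (fζ y₃ y₂ q)
    ∼₁₃-linked {p} {q} c =
      compositeKernel-linked (proj₁ (proj₂ (ζ-comp y₁ y₂ y₃)) _ c) (Sf.relOf-sound y₃ p q)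

    f-composite-linked : ∀ x → Linked (fζ y₁ y₂ x) (fζ y₃ y₂ (fζ y₁ y₃ x))
    f-composite-linked x =
      let v , hv , h = proj₂ (proj₂ (ζ-comp y₁ y₂ y₃)) x (fζ y₁ y₃ x)
                         (from (Fibre.inCoset⇔∼ y₁ y₃) (Fibre.∼-refl y₁ y₃))
      in CA.∼-sym (f-roundtrip y₃ y₂ (fζ y₁ y₂ x)) ∷ᴬ compositeKernel-linked hv h

    twoStepCount-over : ∀ t s {t'' x₁ x₃ θ} →
      T (qrel (Sy y₃) (C″ y₁ y₃) t'' (fζ y₁ y₃ x₁) x₃) →
      QRelEq (Sy y₂) (C″ y₃ y₂) (gζ y₃ y₂ t'') θ →
      twoStepCount t s (fζ y₁ y₂ x₁) (fζ y₃ y₂ x₃)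
        ≡ pairCount (Sy y₂) (λ i j → CB.sameClass t i ∧ CA.sameClass s j) θ
    twoStepCount-over t s {t''} {x₁} {x₃} hq g₃₂t''≡θ =
      let α , β , cα , cβ , hαβ = Fibre.qrel-elim y₁ y₃ hq
          hθ = T-subst (g₃₂t''≡θ _ _)
                 (Hom.g-hom (ζ y₃ y₂) t'' α β
                   (ClosedSubset.rel⇒qrel (Sy y₃) (Hom.C₁ (ζ y₃ y₂)) (Hom.C₁-closed (ζ y₃ y₂)) hαβ))
          α̂ , β̂ , cα̂ , cβ̂ , hα̂β̂ = CA.qrel-elim hθ
      in begin
        twoStepCount t s (fζ y₁ y₂ x₁) (fζ y₃ y₂ x₃)
          ≡⟨ Linked-moveˡ t s (Linked-trans (f-composite-linked x₁)
                                            (Linked-trans (∼₁₃-linked cα) (cα̂ ∷ᴬ []))) ⟩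
        twoStepCount t s α̂ (fζ y₃ y₂ x₃)
          ≡⟨ Linked-moveʳ t s (Linked-trans (∼₁₃-linked cβ) (cβ̂ ∷ᴬ [])) ⟩
        twoStepCount t s α̂ β̂
          ≡⟨ twoStepCount≡pairCount t s hα̂β̂ ⟩
        pairCount (Sy y₂) (λ i j → CB.sameClass t i ∧ CA.sameClass s j) _
          ∎
      where open ≡-Reasoning

  module Regularity (u u' : Fin ru) (t t' : Fin r) where
    u₁ = Uf.source u
    u₂ = Uf.target u
    v₁ = Uf.source u'
    v₂ = Uf.target u'

    fibreCount : Fin m → Fin n → Fin m → Fin m → Fin n → ℕ
    fibreCount y₁ x₁ y₂ y₃ x₃ = countL (allFin n) λ x →
      qrel (Sy y₂) (C″ y₁ y₂) t (fζ y₁ y₂ x₁) x ∧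
      qrel (Sy y₃) (C″ y₂ y₃) t' (fζ y₂ y₃ x) x₃

    -- The value of every fibre count over [u'', t''], read off at the chosen pairs of u and u'*.
    K : Fin r → ℕ
    K t'' = pairCount S (λ i j → Fibre.sameClass u₁ u₂ t i ∧ Fibre.sameClass v₂ v₁ (gζ v₂ v₁ t') j)
                        (gζ v₂ v₁ t'')

    fibreCount≡twoStepCount : ∀ y₁ x₁ y₂ y₃ x₃ →
      fibreCount y₁ x₁ y₂ y₃ x₃
        ≡ Triangle.twoStepCount y₁ y₂ y₃ t (gζ y₃ y₂ t') (fζ y₁ y₂ x₁) (fζ y₃ y₂ x₃)
    fibreCount≡twoStepCount y₁ x₁ y₂ y₃ x₃ = countL-cong (allFin n) λ x →
      cong (qrel (Sy y₂) (C″ y₁ y₂) t (fζ y₁ y₂ x₁) x ∧_)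
        (trans (sym (qrel-transport y₃ y₂ t' (fζ y₂ y₃ x) x₃))
               (Fibre.qrel-cong y₃ y₂ (f-roundtrip y₃ y₂ x) (Fibre.∼-refl y₃ y₂)))

    fibreCount≡K : ∀ {u'' t'' y₁ x₁ y₂ y₃ x₃} → T (R (u'' , t'') (y₁ , x₁) (y₃ , x₃)) →
                   u ∈U (y₁ , y₂) → u' ∈U (y₂ , y₃) → fibreCount y₁ x₁ y₂ y₃ x₃ ≡ K t''
    fibreCount≡K {u''} {t''} {y₁} {x₁} {y₂} {y₃} {x₃} hk h₁₂ h₂₃ = begin
      fibreCount y₁ x₁ y₂ y₃ x₃
        ≡⟨ fibreCount≡twoStepCount y₁ x₁ y₂ y₃ x₃ ⟩
      Triangle.twoStepCount y₁ y₂ y₃ t (gζ y₃ y₂ t') (fζ y₁ y₂ x₁) (fζ y₃ y₂ x₃)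
        ≡⟨ Triangle.twoStepCount-over y₁ y₂ y₃ t (gζ y₃ y₂ t')
             (∧-proj₂ {Scheme.rel U u'' y₁ y₃} hk)
             (g-invariant h₃₂ v₂v₁∈u'*) ⟩
      pairCount (Sy y₂) (λ i j → Fibre.sameClass y₁ y₂ t i ∧ Fibre.sameClass y₃ y₂ (gζ y₃ y₂ t') j)
                (gζ v₂ v₁ t'')
        ≡⟨ pairCount-cong {S = Sy y₂} {S' = S} (IsTauScheme.a-pres (tau y₂))
             (λ i j → cong₂ _∧_
               (sameClass-invariant h₁₂ (Uf.rel-source-target u) t i)
               (sameClass-g-invariant h₃₂ v₂v₁∈u'* t' j))
             _ ⟩
      K t''
        ∎
      where
        open ≡-Reasoning
        h₃₂ = ∈U-transpose h₂₃
        v₂v₁∈u'* = ∈U-transpose (Uf.rel-source-target u')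

    R-pathCount≡ : ∀ {u'' t'' y₁ x₁ y₃ x₃} → T (R (u'' , t'') (y₁ , x₁) (y₃ , x₃)) →
      R-pathCount (u , t) (u' , t') (y₁ , x₁) (y₃ , x₃) ≡ Uf.pathCount u u' y₁ y₃ * K t''
    R-pathCount≡ {u''} {t''} {y₁} {x₁} {y₃} {x₃} hk = begin
      R-pathCount (u , t) (u' , t') (y₁ , x₁) (y₃ , x₃)
        ≡⟨ countL-cartesianProduct id (allFin n) through ⟩
      sum (λ y → countL (allFin n) (λ x → through (y , x)))
        ≡⟨ sum-cong-≗ {m} (λ y →
             trans (countL-∧-gate (allFin n) (Scheme.rel U u y₁ y) (Scheme.rel U u' y y₃) _ _)
                   (if-cong-gated (onPath y) λ h → fibreCount≡K hk (∧-proj₁ h) (∧-proj₂ h))) ⟩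
      sum (λ y → if onPath y then K t'' else 0)
        ≡⟨ sum-indicator-* onPath (K t'') ⟩
      sum (λ y → indicator (onPath y)) * K t''
        ≡⟨ cong (_* K t'') (sym (countL-allFin {m} onPath)) ⟩
      Uf.pathCount u u' y₁ y₃ * K t''
        ∎
      where
        open ≡-Reasoning
        through : Fin m × Fin n → Bool
        through q = R (u , t) (y₁ , x₁) q ∧ R (u' , t') q (y₃ , x₃)

        onPath : Fin m → Bool
        onPath y = Scheme.rel U u y₁ y ∧ Scheme.rel U u' y y₃

  regular : ∀ i j k p q p' q' → T (R k p q) → T (R k p' q') → R-pathCount i j p q ≡ R-pathCount i j p' q'
  regular (u , t) (u' , t') (u'' , t'') (y₁ , x₁) (y₃ , x₃) (y₁' , x₁') (y₃' , x₃') hk hk' = begin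
    R-pathCount (u , t) (u' , t') (y₁ , x₁) (y₃ , x₃)
      ≡⟨ R-pathCount≡ hk ⟩
    Uf.pathCount u u' y₁ y₃ * K t''
      ≡⟨ cong (_* K t'') (trans (Uf.pathCount≡a (∧-proj₁ hk)) (sym (Uf.pathCount≡a (∧-proj₁ hk')))) ⟩
    Uf.pathCount u u' y₁' y₃' * K t''
      ≡⟨ sym (R-pathCount≡ hk') ⟩
    R-pathCount (u , t) (u' , t') (y₁' , x₁') (y₃' , x₃')
      ∎
    where
      open ≡-Reasoning
      open Regularity u u' t t'

  isSchemeFamily : IsSchemeFamily (cartesianProduct (allFin m) (allFin n)) R
  isSchemeFamily = record
    { nonempty  = nonempty
    ; disjoint  = disjoint
    ; cover     = cover
    ; diagonal  = diagonal
    ; transpose = transpose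
    ; regular   = regular
    }

corollary4p9 : ∀ {n m r ru} (x* : Fin n) (S : Scheme n r) (y* : Fin m) (U : Scheme m ru)
                 (ζ : Action x* S y* U) →
                 IsSchemeFamily (cartesianProduct (allFin m) (allFin n)) (semidirect ζ)
corollary4p9 x* S y* U ζ = SemidirectProduct.isSchemeFamily ζ
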